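{- Let $m\ge3$ be odd and let $\tau^{(n)}$ be as defined in the context. For every $n\ge1$, if $\tau^{(n)}(v_1,\dots,v_n)=(t_1,\dots,t_n)$ then $$v_n=\Bigl(2^{n-1}t_n-\sum_{j=1}^{n-1}2^{j-1}t_j\Bigr)\bmod m.$$
   Context: Fix an odd $m\ge3$ and $c=2^{ -1}\bmod m=(m+1)/2$. Define maps $\tau^{(n)}:\{0,\dots,m-1\}^n\to\{0,\dots,m-1\}^n$ recursively: $\tau^{(1)}$ is the identity, and for $n\ge2$, $\tau^{(n)}(v_1,\dots,v_n)=\bigl(v_1,\ \tau^{(n-1)}(c(v_1+v_2)\bmod m,\dots,c(v_1+v_n)\bmod m)\bigr)$. -}

module Defs where

open import Data.Nat using (ℕ; zero; suc; _+_; _*_; _^_; NonZero)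
open import Data.Nat.DivMod using (_%_)
open import Data.Fin using (Fin; toℕ)
open import Data.Vec using (Vec; []; _∷_; map)

-- c = 2⁻¹ mod m = (m+1)/2, given as a parameter-free formula in terms of m.
-- For odd m = 2k+1 we have c = k+1.  We let the map depend on m and on c
-- via the explicit formula below.
half⁻¹ : ℕ → ℕ
half⁻¹ m = Data.Nat.DivMod._/_ (suc m) 2

cSum : (m : ℕ) .{{_ : NonZero m}} → Fin m → Fin m → Fin m
cSum m a b = Data.Nat.DivMod._mod_ (half⁻¹ m * (toℕ a + toℕ b)) m

τ : (m : ℕ) .{{_ : NonZero m}} → (n : ℕ) → Vec (Fin m) n → Vec (Fin m) n
τ m zero [] = []
τ m (suc zero) (v ∷ []) = v ∷ []
τ m (suc (suc n)) (v ∷ vs) = v ∷ τ m (suc n) (map (cSum m v) vs)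

open import Data.List using (List; foldr)
import Data.Integer as ℤ
sumℤ : List ℤ.ℤ → ℤ.ℤ
sumℤ = foldr ℤ._+_ (ℤ.+ 0)

-- τ(v) = (v₁, τ(w)) with w = (c(v₁+v₂), …, c(v₁+vₙ)). Since 2c ≡ 1 (mod m), the last
-- entry of w satisfies 2w_{n-1} ≡ v₁ + vₙ, i.e. vₙ ≡ 2w_{n-1} − t₁. By induction w_{n-1}
-- is given by the formula applied to τ(w) = (t₂, …, tₙ); substituting yields the formula
-- for vₙ as a congruence of integers, and since 0 ≤ vₙ < m it is the reduced residue.
module Submission where

open import Defs
open import Data.Nat using (ℕ; suc; _≥_; _^_; NonZero)
open import Data.Nat.DivMod using (_%_)
open import Data.Fin using (Fin; toℕ; zero; suc; inject₁; fromℕ)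
open import Data.Vec using (Vec; lookup)
open import Data.Integer using (ℤ; +_; _-_; _*_)
open import Data.Integer.DivMod using (_%ℕ_)
open import Data.List using (map)
open import Data.List.Base using (allFin)
open import Relation.Binary.PropositionalEquality using (_≡_)

open import Data.Integer using (_+_; -_; ∣_∣)
import Data.Integer.Properties as ℤ
open import Data.Integer.DivMod using (_/ℕ_; n%ℕd<d; a≡a%ℕn+[a/ℕn]*n)
open import Data.Integer.Divisibility.Signed using (_∣_; divides; ∣⇒∣ᵤ; ∣n⇒∣m*n; ∣m∣n⇒∣m+n)
open import Data.Integer.Tactic.RingSolver using (solve-∀)
import Data.Nat as ℕ
import Data.Nat.Properties as ℕ
import Data.Nat.DivMod as ℕ
import Data.Nat.Divisibility as ℕ
open import Data.Fin.Properties using (toℕ<n; toℕ-fromℕ<)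
open import Data.Vec using ([]; _∷_)
open import Data.Vec.Properties using (lookup-map)
open import Data.List using ([]; _∷_)
open import Data.List.Properties using (map-tabulate; map-cong)
open import Function using (_∘_; id)
open import Level using (0ℓ)
open import Relation.Binary.Bundles using (Setoid)
open import Relation.Binary.Structures using (IsEquivalence)
open import Relation.Binary.PropositionalEquality using (refl; sym; trans; cong; cong₂; subst; module ≡-Reasoning)
import Relation.Binary.Reasoning.Setoid as SetoidReasoning

infix 4 _≡_mod_

-- A record rather than a synonym for divisibility, so that a and b can be inferred.
record _≡_mod_ (a b : ℤ) (m : ℕ) : Set where
  constructor mod-by
  field divides-difference : + m ∣ a - b

module _ {m : ℕ} where

  mod-scale : ∀ k {a b c d} → c - d ≡ k * (a - b) → a ≡ b mod m → c ≡ d mod m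
  mod-scale k eq (mod-by m∣a-b) = mod-by (subst (+ m ∣_) (sym eq) (∣n⇒∣m*n k m∣a-b))

  ≡⇒≡-mod : ∀ {a b} → a ≡ b → a ≡ b mod m
  ≡⇒≡-mod {a} refl = mod-by (divides (+ 0) (ℤ.+-inverseʳ a))

  mod-sym : ∀ {a b} → a ≡ b mod m → b ≡ a mod m
  mod-sym {a} {b} = mod-scale (- + 1) (eq a b)
    where
    eq : ∀ a b → b - a ≡ - + 1 * (a - b)
    eq = solve-∀

  mod-trans : ∀ {a b c} → a ≡ b mod m → b ≡ c mod m → a ≡ c mod m
  mod-trans {a} {b} {c} (mod-by m∣a-b) (mod-by m∣b-c) =
    mod-by (subst (+ m ∣_) (eq a b c) (∣m∣n⇒∣m+n m∣a-b m∣b-c))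
    where
    eq : ∀ a b c → (a - b) + (b - c) ≡ a - c
    eq = solve-∀

  mod-+-congʳ : ∀ x {a b} → a ≡ b mod m → a + x ≡ b + x mod m
  mod-+-congʳ x {a} {b} = mod-scale (+ 1) (eq a b x)
    where
    eq : ∀ a b x → (a + x) - (b + x) ≡ + 1 * (a - b)
    eq = solve-∀

  mod-*-congˡ : ∀ x {a b} → a ≡ b mod m → x * a ≡ x * b mod m
  mod-*-congˡ x {a} {b} = mod-scale x (eq x a b)
    where
    eq : ∀ x a b → x * a - x * b ≡ x * (a - b)
    eq = solve-∀

  mod-isEquivalence : IsEquivalence (_≡_mod m)
  mod-isEquivalence = record
    { refl = ≡⇒≡-mod refl ; sym = mod-sym ; trans = mod-trans }

  mod-setoid : Setoid 0ℓ 0ℓ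
  mod-setoid = record { isEquivalence = mod-isEquivalence }

  +-*-≡mod : ∀ i k → i + k * + m ≡ i mod m
  +-*-≡mod i k = mod-by (divides k (eq i k (+ m)))
    where
    eq : ∀ i k m → (i + k * m) - i ≡ k * m
    eq = solve-∀

  module _ .{{_ : NonZero m}} where

    %ℕ-≡mod : ∀ i → + (i %ℕ m) ≡ i mod m
    %ℕ-≡mod i = mod-sym (subst (_≡ + (i %ℕ m) mod m) (sym (a≡a%ℕn+[a/ℕn]*n i m))
      (+-*-≡mod (+ (i %ℕ m)) (i /ℕ m)))

    ≡-mod⇒≡ : ∀ {a b} → a ℕ.< m → b ℕ.< m → + a ≡ + b mod m → a ≡ b
    ≡-mod⇒≡ {a} {b} a<m b<m (mod-by m∣a-b) = ℤ.+-injective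
      (ℤ.i-j≡0⇒i≡j (+ a) (+ b) (ℤ.∣i∣≡0⇒i≡0 ∣a-b∣≡0))
      where
      ∣a-b∣<m : ∣ + a - + b ∣ ℕ.< m
      ∣a-b∣<m = subst (ℕ._< m) (cong ∣_∣ (sym (ℤ.m-n≡m⊖n a b)))
        (ℕ.≤-<-trans (ℤ.∣m⊝n∣≤m⊔n a b) (ℕ.⊔-pres-<m a<m b<m))
      ∣a-b∣≡0 : ∣ + a - + b ∣ ≡ 0
      ∣a-b∣≡0 = trans (sym (ℕ.m<n⇒m%n≡m ∣a-b∣<m)) (ℕ.n∣m⇒m%n≡0 _ m (∣⇒∣ᵤ m∣a-b))

map-allFin-suc : ∀ {a} {A : Set a} n (f : Fin (suc n) → A) →
  map f (allFin (suc n)) ≡ f zero ∷ map (f ∘ suc) (allFin n)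
map-allFin-suc n f = cong (λ xs → f zero ∷ xs) (trans (map-tabulate suc f) (sym (map-tabulate id (f ∘ suc))))

sumℤ-map-*ˡ : ∀ {a} {A : Set a} c (f : A → ℤ) xs → sumℤ (map (λ x → c * f x) xs) ≡ c * sumℤ (map f xs)
sumℤ-map-*ˡ c f []       = sym (ℤ.*-zeroʳ c)
sumℤ-map-*ˡ c f (x ∷ xs) = trans (cong (λ s → c * f x + s) (sumℤ-map-*ˡ c f xs))
                                  (sym (ℤ.*-distribˡ-+ c (f x) (sumℤ (map f xs))))

weightedSum : ∀ {m} n → Vec (Fin m) (suc n) → ℤ
weightedSum n t = sumℤ (map (λ k → + (2 ^ toℕ k) * + toℕ (lookup t (inject₁ k))) (allFin n))

inverseFormula : ∀ {m} n → Vec (Fin m) (suc n) → ℤ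
inverseFormula n t = + (2 ^ n) * + toℕ (lookup t (fromℕ n)) - weightedSum n t

weightedSum-∷ : ∀ {m} n (x : Fin m) t → weightedSum (suc n) (x ∷ t) ≡ + toℕ x + + 2 * weightedSum n t
weightedSum-∷ n x t = begin
  sumℤ (map term (allFin (suc n)))
    ≡⟨ cong sumℤ (map-allFin-suc n term) ⟩
  + 1 * + toℕ x + sumℤ (map (term ∘ suc) (allFin n))
    ≡⟨ cong₂ _+_ (ℤ.*-identityˡ (+ toℕ x)) (cong sumℤ (map-cong double (allFin n))) ⟩
  + toℕ x + sumℤ (map (λ k → + 2 * term′ k) (allFin n))
    ≡⟨ cong (λ s → + toℕ x + s) (sumℤ-map-*ˡ (+ 2) term′ (allFin n)) ⟩
  + toℕ x + + 2 * weightedSum n t ∎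
  where
  open ≡-Reasoning
  term : Fin (suc n) → ℤ
  term k = + (2 ^ toℕ k) * + toℕ (lookup (x ∷ t) (inject₁ k))
  term′ : Fin n → ℤ
  term′ k = + (2 ^ toℕ k) * + toℕ (lookup t (inject₁ k))
  double : ∀ k → term (suc k) ≡ + 2 * term′ k
  double k = trans (cong (_* + toℕ (lookup t (inject₁ k))) (ℤ.pos-* 2 (2 ^ toℕ k)))
                   (ℤ.*-assoc (+ 2) (+ (2 ^ toℕ k)) (+ toℕ (lookup t (inject₁ k))))

inverseFormula-∷ : ∀ {m} n (x : Fin m) t → inverseFormula (suc n) (x ∷ t) ≡ + 2 * inverseFormula n t - + toℕ x
inverseFormula-∷ n x t = begin
  + (2 ℕ.* 2 ^ n) * last - weightedSum (suc n) (x ∷ t)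
    ≡⟨ cong₂ (λ p s → p * last - s) (ℤ.pos-* 2 (2 ^ n)) (weightedSum-∷ n x t) ⟩
  + 2 * + (2 ^ n) * last - (+ toℕ x + + 2 * weightedSum n t)
    ≡⟨ eq (+ (2 ^ n)) last (+ toℕ x) (weightedSum n t) ⟩
  + 2 * inverseFormula n t - + toℕ x ∎
  where
  open ≡-Reasoning
  last : ℤ
  last = + toℕ (lookup t (fromℕ n))
  eq : ∀ p l x s → + 2 * p * l - (x + + 2 * s) ≡ + 2 * (p * l - s) - x
  eq = solve-∀

two*half⁻¹ : ∀ m → m % 2 ≡ 1 → 2 ℕ.* half⁻¹ m ≡ suc m
two*half⁻¹ m m-odd = ℕ.m*[n/m]≡n (ℕ.m%n≡0⇒n∣m (suc m) 2 (begin
  (1 ℕ.+ m) % 2            ≡⟨ ℕ.%-distribˡ-+ 1 m 2 ⟩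
  (1 % 2 ℕ.+ m % 2) % 2    ≡⟨ cong (λ r → (1 ℕ.+ r) % 2) m-odd ⟩
  0                        ∎))
  where open ≡-Reasoning

module _ {m : ℕ} .{{_ : NonZero m}} (m-odd : m % 2 ≡ 1) where

  open SetoidReasoning (mod-setoid {m})

  cSum-double : ∀ a b → + 2 * + toℕ (cSum m a b) ≡ + toℕ a + + toℕ b mod m
  cSum-double a b = begin
    + 2 * + toℕ (cSum m a b)    ≡⟨ cong (λ r → + 2 * + r) (toℕ-fromℕ< (ℕ.m%n<n (c ℕ.* s) m)) ⟩
    + 2 * + ((c ℕ.* s) % m)     ≈⟨ mod-*-congˡ (+ 2) (%ℕ-≡mod (+ (c ℕ.* s))) ⟩
    + 2 * + (c ℕ.* s)           ≡⟨ ℤ.pos-* 2 (c ℕ.* s) ⟨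
    + (2 ℕ.* (c ℕ.* s))         ≡⟨ cong +_ (ℕ.*-assoc 2 c s) ⟨
    + (2 ℕ.* c ℕ.* s)           ≡⟨ cong (λ k → + (k ℕ.* s)) (two*half⁻¹ m m-odd) ⟩
    + (s ℕ.+ m ℕ.* s)           ≡⟨ ℤ.pos-+ s (m ℕ.* s) ⟩
    + s + + (m ℕ.* s)           ≡⟨ cong (λ k → + s + + k) (ℕ.*-comm m s) ⟩
    + s + + (s ℕ.* m)           ≡⟨ cong (λ k → + s + k) (ℤ.pos-* s m) ⟩
    + s + + s * + m             ≈⟨ +-*-≡mod (+ s) (+ s) ⟩
    + s                         ≡⟨ ℤ.pos-+ (toℕ a) (toℕ b) ⟩
    + toℕ a + + toℕ b           ∎
    where
    c s : ℕ
    c = half⁻¹ m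
    s = toℕ a ℕ.+ toℕ b

  last-≡-inverseFormula : ∀ n (v : Vec (Fin m) (suc n)) →
    + toℕ (lookup v (fromℕ n)) ≡ inverseFormula n (τ m (suc n) v) mod m
  last-≡-inverseFormula ℕ.zero (x ∷ []) = ≡⇒≡-mod (sym (eq (+ toℕ x)))
    where
    eq : ∀ x → + 1 * x - + 0 ≡ x
    eq = solve-∀
  last-≡-inverseFormula (suc n) (x ∷ vs) = begin
    Y                                            ≡⟨ eq X Y ⟩
    X + Y - X                                    ≈⟨ mod-+-congʳ (- X) (mod-sym (cSum-double x y)) ⟩
    + 2 * + toℕ (cSum m x y) - X                 ≡⟨ cong (λ z → + 2 * + toℕ z - X) (lookup-map (fromℕ n) (cSum m x) vs) ⟨
    + 2 * + toℕ (lookup w (fromℕ n)) - X         ≈⟨ mod-+-congʳ (- X) (mod-*-congˡ (+ 2) (last-≡-inverseFormula n w)) ⟩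
    + 2 * inverseFormula n (τ m (suc n) w) - X   ≡⟨ inverseFormula-∷ n x (τ m (suc n) w) ⟨
    inverseFormula (suc n) (x ∷ τ m (suc n) w)   ∎
    where
    y : Fin m
    y = lookup vs (fromℕ n)
    w : Vec (Fin m) (suc n)
    w = Data.Vec.map (cSum m x) vs
    X Y : ℤ
    X = + toℕ x
    Y = + toℕ y
    eq : ∀ x y → y ≡ x + y - x
    eq = solve-∀

theorem9 : (m : ℕ) .{{_ : NonZero m}} → m ≥ 3 → m % 2 ≡ 1 →
    (n' : ℕ) → (v t : Vec (Fin m) (suc n')) → τ m (suc n') v ≡ t →
    toℕ (lookup v (fromℕ n'))
    ≡ ((+ (2 ^ n') * + toℕ (lookup t (fromℕ n')))
    - sumℤ (map (λ k → + (2 ^ toℕ k) * + toℕ (lookup t (inject₁ k))) (allFin n'))) %ℕ m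
theorem9 m _ m-odd n' v t refl =
  ≡-mod⇒≡ (toℕ<n (lookup v (fromℕ n'))) (n%ℕd<d (inverseFormula n' t) m)
    (mod-trans (last-≡-inverseFormula m-odd n' v) (mod-sym (%ℕ-≡mod (inverseFormula n' t))))
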